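{- Let $u > v$ be positive integers with $v^2 + v - 1 \equiv 0 \pmod{u}$. Suppose the sequence of quotients of $\mathrm{EA}(u,v,1)$ is $$q_1, \ldots, q_{s-1},\ q_s + \delta_1,\ 1,\ q_s + \delta_0,\ q_{s-1}, \ldots, q_1$$ for some $s\ge 1$ and positive integers $q_1,\ldots,q_s$, where $(\delta_1,\delta_0) = (1,0)$ if $s$ is odd and $(\delta_1,\delta_0)=(0,1)$ if $s$ is even (under the congruence hypothesis the quotient sequence always has this form). Let $(r_i)_{i=-1}^{2s+1}$ be the sequence of remainders of $\mathrm{EA}(u,v,1)$, and for $i = -1, \ldots, s-1$ set $t_i = r_i + (-1)^{i+1} r_{2s-i}$. Then $\mathrm{EA}(u, v-1, 0)$ is the sequence of $2s$ equations \begin{align*} t_{i-2} &= q_i \cdot t_{i-1} + t_i \quad \text{for } 1 \le i \le s-1,\\ t_{s-2} &= (q_s + 3\delta_1)\cdot t_{s-1} + r_{s+1},\\ t_{s-1} &= (q_s + 3\delta_0)\cdot r_{s+1} + r_{s+2},\\ r_{i-1} &= q_{2s+1-i}\cdot r_i + r_{i+1} \quad \text{for } s+2 \le i \le 2s, \end{align*} listed in order (so these give its quotients and remainders).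
   Context: Standard Euclidean algorithm with positive integers $U > V$: $r_{ -1}=U$, $r_0=V$, and for $i\ge1$, $r_{i-2} = q_i r_{i-1} + r_i$ with $0\le r_i<r_{i-1}$, stopping at the first $s$ with $r_s = 0$ (so $q_s\ge 2$). Modified Euclidean algorithm: the final equation $r_{s-2} = q_s r_{s-1} + 0$ is replaced by the two equations $r_{s-2} = (q_s - 1) r_{s-1} + r_{s-1}$ and $r_{s-1} = 1\cdot r_{s-1} + 0$. $\mathrm{EA}(U,V,0)$ denotes the sequence of equations of whichever of the standard or modified algorithm has an even number of equations, and $\mathrm{EA}(U,V,1)$ whichever has an odd number; its quotients and remainders (with $r_{ -1} = U$, $r_0 = V$) are read off from its equations $r_{i-2}=q_ir_{i-1}+r_i$. -}

module Defs where

open import Data.Nat using (ℕ; zero; suc; _+_; _*_; _∸_; _≡ᵇ_)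
open import Data.Nat.DivMod using (_/_; _%_)
open import Data.Bool using (if_then_else_)
open import Data.Product using (_×_; _,_; proj₁; proj₂)
open import Data.List using (List; []; _∷_; _++_; map; length; applyUpTo; applyDownFrom)

-- An equation  a = q * b + r  of a Euclidean algorithm, stored as (a , q , b , r).
Eqn : Set
Eqn = ℕ × ℕ × ℕ × ℕ

quotient : Eqn → ℕ
quotient (a , q , b , r) = q

remainder : Eqn → ℕ
remainder (a , q , b , r) = r

-- Standard Euclidean algorithm on (a , b), with fuel (fuel suc b suffices, since b strictly decreases).
stdEA′ : ℕ → ℕ → ℕ → List Eqn
stdEA′ zero    a b       = []
stdEA′ (suc f) a zero    = []
stdEA′ (suc f) a (suc b) = (a , a / suc b , suc b , a % suc b) ∷ stdEA′ f (suc b) (a % suc b)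

stdEA : ℕ → ℕ → List Eqn
stdEA U V = stdEA′ (suc V) U V

modifyLast : List Eqn → List Eqn
modifyLast []                         = []
modifyLast ((a , q , b , r) ∷ [])     = (a , q ∸ 1 , b , b) ∷ (b , 1 , b , 0) ∷ []
modifyLast (e ∷ es)                   = e ∷ modifyLast es

modEA : ℕ → ℕ → List Eqn
modEA U V = modifyLast (stdEA U V)

-- EA(U,V,p) for p ∈ {0,1}: whichever of the standard / modified algorithm has
-- number of equations ≡ p (mod 2).
EA : ℕ → ℕ → ℕ → List Eqn
EA U V p = if (length (stdEA U V) % 2) ≡ᵇ p then stdEA U V else modEA U V

quotients : List Eqn → List ℕ
quotients = map quotient

-- list of remainders r_{-1}, r_0, r_1, ..., r_n  (r_{-1} = U, r_0 = V)
remainders : ℕ → ℕ → List Eqn → List ℕ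
remainders U V es = U ∷ V ∷ map remainder es

-- k-th element of a list (0-based), default 0 out of range
nth : List ℕ → ℕ → ℕ
nth []       k       = 0
nth (x ∷ xs) zero    = x
nth (x ∷ xs) (suc k) = nth xs k

δ₁ : ℕ → ℕ
δ₁ s = s % 2

δ₀ : ℕ → ℕ
δ₀ s = 1 ∸ (s % 2)

palQuotients : ℕ → (ℕ → ℕ) → List ℕ
palQuotients s q =
  applyUpTo (λ k → q (suc k)) (s ∸ 1)
  ++ (q s + δ₁ s) ∷ 1 ∷ (q s + δ₀ s) ∷ []
  ++ applyDownFrom (λ k → q (suc k)) (s ∸ 1)

-- Shifted indexing: R j = r_{j-1} (so R 0 = r_{-1} = u), remainders of EA(u,v,1).
R : ℕ → ℕ → ℕ → ℕ
R u v j = nth (remainders u v (EA u v 1)) j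

-- T j = t_{j-1} = r_{j-1} + (-1)^j r_{2s-j+1}   (0 ≤ j ≤ s).
-- For j ≤ s one has 2s-j+1 > j-1, so r_{2s-j+1} ≤ r_{j-1} and truncated subtraction is exact.
T : ℕ → ℕ → ℕ → ℕ → ℕ
T u v s j = if (j % 2) ≡ᵇ 0
            then R u v j + R u v (2 * s + 2 ∸ j)
            else R u v j ∸ R u v (2 * s + 2 ∸ j)

claimedEqns : ℕ → ℕ → ℕ → (ℕ → ℕ) → List Eqn
claimedEqns u v s q =
  applyUpTo (λ k → let i = suc k in (T u v s (i ∸ 1) , q i , T u v s i , T u v s (suc i))) (s ∸ 1)
  ++ (T u v s (s ∸ 1) , q s + 3 * δ₁ s , T u v s s , R u v (s + 2))
  ∷ (T u v s s , q s + 3 * δ₀ s , R u v (s + 2) , R u v (s + 3))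
  ∷ []
  ++ applyUpTo (λ k → let i = k + (s + 2) in
                 (R u v i , q (2 * s + 1 ∸ i) , R u v (suc i) , R u v (suc (suc i)))) (s ∸ 1)

module Submission where

-- Write r_j for the remainders of EA(u, v, 1), whose last non-zero one is gcd(u, v) = 1 by
-- the congruence. As its quotient sequence is a palindrome up to the three middle entries,
-- the reversed remainders r̄_j = r_{2s+1-j} obey the same three-term recurrence as the r_j,
-- read backwards. Hence the alternating combinations t_j = r_j ± r̄_j obey it with the
-- quotients q_1, ..., q_{s-1}; at the turn the three middle equations fold into the two
-- stated ones, and from there on the tail of EA(u, v, 1) continues unchanged. Starting from
-- t_{-1} = u and t_0 = v - 1 these 2s equations have strictly decreasing remainders ending
-- in 1, 0, so they form a run of the standard or modified algorithm of even length, i.e.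
-- EA(u, v - 1, 0).

open import Defs
open import Data.Nat using (ℕ; zero; suc; _+_; _*_; _∸_; _<_; _≤_; z≤n; s≤s; _≡ᵇ_; _≤ᵇ_; >-nonZero)
open import Data.Nat.Properties
open import Data.Nat.DivMod using (_/_; _%_; m≡m%n+[m/n]*n; m%n<n; [m+kn]%n≡m%n; [m+n]%n≡m%n; m<n⇒m%n≡m; m≥n⇒m/n>0; %-distribˡ-+; m*n%n≡0)
open import Data.Nat.Divisibility using (_∣_; ∣-refl; ∣n⇒∣m*n; ∣m∣n⇒∣m+n; ∣m+n∣m⇒∣n; ∣-trans; ∣1⇒≡1)
open import Data.Nat.Tactic.RingSolver using (solve; solve-∀)
open import Data.Bool using (true; false; if_then_else_)
open import Data.Bool.Properties using (T-≡; ¬-not)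
open import Data.Product using (_×_; _,_; proj₁; proj₂; Σ-syntax; ∃-syntax)
open import Data.Sum using (_⊎_; inj₁; inj₂)
open import Data.List using (List; []; _∷_; _++_; length; applyUpTo; applyDownFrom)
open import Data.List.Properties using (length-map; length-++; length-applyUpTo; length-applyDownFrom)
open import Function.Bundles using (Equivalence)
open import Relation.Binary.Definitions using (tri<; tri≈; tri>)
open import Relation.Binary.PropositionalEquality

data EuclidChain : ℕ → ℕ → List Eqn → Set where
  done     : ∀ {a q b} → 0 < b → a ≡ q * b → EuclidChain a b ((a , q , b , 0) ∷ [])
  done-mod : ∀ {a q b} → 0 < b → a ≡ q * b + b →
             EuclidChain a b ((a , q , b , b) ∷ (b , 1 , b , 0) ∷ [])
  step     : ∀ {a q b r es} → r < b → a ≡ q * b + r → EuclidChain b r es →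
             EuclidChain a b ((a , q , b , r) ∷ es)

divMod-unique : ∀ a q b r → r < suc b → a ≡ q * suc b + r → a / suc b ≡ q × a % suc b ≡ r
divMod-unique a q b r r<b a≡ = quot , rem
  where
  open ≡-Reasoning
  rem : a % suc b ≡ r
  rem = begin
    a % suc b               ≡⟨ cong (_% suc b) (trans a≡ (+-comm (q * suc b) r)) ⟩
    (r + q * suc b) % suc b ≡⟨ [m+kn]%n≡m%n r q (suc b) ⟩
    r % suc b               ≡⟨ m<n⇒m%n≡m r<b ⟩
    r                       ∎
  quot : a / suc b ≡ q
  quot = *-cancelʳ-≡ (a / suc b) q (suc b) (+-cancelˡ-≡ r _ _ (begin
    r + a / suc b * suc b       ≡⟨ cong (_+ a / suc b * suc b) rem ⟨
    a % suc b + a / suc b * suc b ≡⟨ m≡m%n+[m/n]*n a (suc b) ⟨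
    a                           ≡⟨ trans a≡ (+-comm (q * suc b) r) ⟩
    r + q * suc b               ∎))

stdEA′-0 : ∀ f a → stdEA′ f a 0 ≡ []
stdEA′-0 zero    a = refl
stdEA′-0 (suc f) a = refl

stdEA′-of-chain : ∀ {a b es} → EuclidChain a b es → ∀ f → b < f →
  Σ[ L ∈ List Eqn ] stdEA′ f a b ≡ L × (L ≡ es ⊎ modifyLast L ≡ es × suc (length L) ≡ length es)
stdEA′-of-chain (done {a} {q} {suc b} _ a≡) (suc f) _
  with divMod-unique a q b 0 (s≤s z≤n) (trans a≡ (sym (+-identityʳ _)))
... | quot , rem rewrite quot | rem | stdEA′-0 f (suc b) = _ , refl , inj₁ refl
stdEA′-of-chain (done-mod {a} {q} {suc b} _ a≡) (suc f) _
  with divMod-unique a (suc q) b 0 (s≤s z≤n) (trans a≡ (trans (+-comm (q * suc b) (suc b)) (sym (+-identityʳ _))))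
... | quot , rem rewrite quot | rem | stdEA′-0 f (suc b) = _ , refl , inj₂ (refl , refl)
stdEA′-of-chain (step {a} {q} {suc b} {r} r<b a≡ ch) (suc f) (s≤s b<f)
  with divMod-unique a q b r r<b a≡
... | quot , rem rewrite quot | rem with stdEA′-of-chain ch f (<-≤-trans r<b b<f)
... | L , run , inj₁ L≡ = _ , cong (_ ∷_) run , inj₁ (cong (_ ∷_) L≡)
... | e ∷ L , run , inj₂ (L≡ , len) = _ , cong (_ ∷_) run , inj₂ (cong (_ ∷_) L≡ , cong suc len)
... | [] , _ , inj₂ (L≡ , _) with ch | L≡
...   | done _ _     | ()
...   | done-mod _ _ | ()
...   | step _ _ _   | ()

parity : ∀ n → (n % 2 ≡ 0 × suc n % 2 ≡ 1) ⊎ (n % 2 ≡ 1 × suc n % 2 ≡ 0)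
parity n with n % 2 | m%n<n n 2 | %-distribˡ-+ 1 n 2
... | 0 | _ | suc-n = inj₁ (refl , suc-n)
... | 1 | _ | suc-n = inj₂ (refl , suc-n)
... | suc (suc _) | s≤s (s≤s ()) | _

%2-suc-suc : ∀ n → suc (suc n) % 2 ≡ n % 2
%2-suc-suc n = trans (cong (_% 2) (+-comm 2 n)) ([m+n]%n≡m%n n 2)

≡ᵇ-refl : ∀ n → (n ≡ᵇ n) ≡ true
≡ᵇ-refl n = Equivalence.to T-≡ (≡⇒≡ᵇ n n refl)

%2-≡ᵇ-suc : ∀ n → (n % 2 ≡ᵇ suc n % 2) ≡ false
%2-≡ᵇ-suc n with parity n
... | inj₁ (p , p′) rewrite p | p′ = refl
... | inj₂ (p , p′) rewrite p | p′ = refl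

EA-of-chain : ∀ {a b es} → EuclidChain a b es → EA a b (length es % 2) ≡ es
EA-of-chain {a} {b} {es} ch with stdEA′-of-chain ch (suc b) ≤-refl
... | L , run , inj₁ L≡ rewrite run | L≡ | ≡ᵇ-refl (length es % 2) = refl
... | L , run , inj₂ (L≡ , len) rewrite run | sym len | %2-≡ᵇ-suc (length L) = L≡

stdEA′-chain : ∀ f a b → 0 < b → b ≤ a → b < f → EuclidChain a b (stdEA′ f a b)
stdEA′-chain (suc f) a (suc b) _ b≤a (s≤s b<f)
  with a % suc b | m≡m%n+[m/n]*n a (suc b) | m%n<n a (suc b)
... | zero  | a≡ | _ rewrite stdEA′-0 f (suc b) = done (s≤s z≤n) a≡
... | suc r | a≡ | r<b =
  step r<b (trans a≡ (+-comm (suc r) _)) (stdEA′-chain f (suc b) (suc r) (s≤s z≤n) (<⇒≤ r<b) (<-≤-trans r<b b<f))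

modEA′-chain : ∀ f a b → 0 < b → b ≤ a → b < f → EuclidChain a b (modifyLast (stdEA′ f a b))
modEA′-chain (suc f) a (suc b) _ b≤a (s≤s b<f)
  with a % suc b | m≡m%n+[m/n]*n a (suc b) | m%n<n a (suc b) | m≥n⇒m/n>0 {a} {suc b} b≤a
... | zero  | a≡ | _ | q>0 rewrite stdEA′-0 f (suc b) = done-mod (s≤s z≤n) (trans a≡ (split (a / suc b) q>0))
  where
  split : ∀ q → 0 < q → 0 + q * suc b ≡ (q ∸ 1) * suc b + suc b
  split (suc q) _ = +-comm (suc b) (q * suc b)
... | suc r | a≡ | r<b | _ with f | b<f
... | suc f′ | b<f′ =
  step r<b (trans a≡ (+-comm (suc r) _)) (modEA′-chain (suc f′) (suc b) (suc r) (s≤s z≤n) (<⇒≤ r<b) (<-≤-trans r<b b<f′))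

EA-chain : ∀ a b p → 0 < b → b < a → EuclidChain a b (EA a b p)
EA-chain a b p 0<b b<a with (length (stdEA a b) % 2) ≡ᵇ p
... | true  = stdEA′-chain (suc b) a b 0<b (<⇒≤ b<a) ≤-refl
... | false = modEA′-chain (suc b) a b 0<b (<⇒≤ b<a) ≤-refl

chain-eqn : ∀ {a b es} → EuclidChain a b es → ∀ k → k < length es →
  let r = nth (remainders a b es) in r k ≡ nth (quotients es) k * r (suc k) + r (suc (suc k))
chain-eqn (done _ a≡)     zero          _              = trans a≡ (sym (+-identityʳ _))
chain-eqn (done-mod _ a≡) zero          _              = a≡
chain-eqn (done-mod {b = b} _ _) (suc zero) _          = sym (trans (+-identityʳ _) (+-identityʳ b))
chain-eqn (step _ a≡ _)   zero          _              = a≡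
chain-eqn (step _ _ ch)   (suc k)       (s≤s k<n)      = chain-eqn ch k k<n
chain-eqn (done _ _)      (suc k)       (s≤s ())
chain-eqn (done-mod _ _)  (suc (suc k)) (s≤s (s≤s ()))

chain-remainder-< : ∀ {a b es} → EuclidChain a b es → ∀ k → suc (suc k) < length es →
  let r = nth (remainders a b es) in r (suc (suc k)) < r (suc k)
chain-remainder-< (step r<b _ _) zero    _          = r<b
chain-remainder-< (step _ _ ch)  (suc k) (s≤s 2+k<n) = chain-remainder-< ch k 2+k<n
chain-remainder-< (done _ _)     _       (s≤s ())
chain-remainder-< (done-mod _ _) _       (s≤s (s≤s ()))

-- Out of range `nth` is 0, so this holds for every index.
chain-remainder-≤ : ∀ {a b es} → EuclidChain a b es → ∀ k →
  let r = nth (remainders a b es) in r (suc (suc k)) ≤ r (suc k)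
chain-remainder-≤ (done _ _)       zero          = z≤n
chain-remainder-≤ (done _ _)       (suc k)       = z≤n
chain-remainder-≤ (done-mod _ _)   zero          = ≤-refl
chain-remainder-≤ (done-mod _ _)   (suc zero)    = z≤n
chain-remainder-≤ (done-mod _ _)   (suc (suc k)) = z≤n
chain-remainder-≤ (step r<b _ _)   zero          = <⇒≤ r<b
chain-remainder-≤ (step _ _ ch)    (suc k)       = chain-remainder-≤ ch k

chain-remainder-end : ∀ {a b es} → EuclidChain a b es → nth (remainders a b es) (suc (length es)) ≡ 0
chain-remainder-end (done _ _)     = refl
chain-remainder-end (done-mod _ _) = refl
chain-remainder-end (step _ _ ch)  = chain-remainder-end ch

chain-gcd : ∀ {a b es} → EuclidChain a b es →
  let g = nth (remainders a b es) (length es) in g ∣ a × g ∣ b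
chain-gcd (done {q = q} _ a≡)       = subst (_ ∣_) (sym a≡) (∣n⇒∣m*n q ∣-refl) , ∣-refl
chain-gcd (done-mod {q = q} _ a≡)   = subst (_ ∣_) (sym a≡) (∣m∣n⇒∣m+n (∣n⇒∣m*n q ∣-refl) ∣-refl) , ∣-refl
chain-gcd (step {q = q} _ a≡ ch) with chain-gcd ch
... | g∣b , g∣r = subst (_ ∣_) (sym a≡) (∣m∣n⇒∣m+n (∣n⇒∣m*n q g∣b) g∣r) , g∣b

equationAt : (ℕ → ℕ) → (ℕ → ℕ) → ℕ → Eqn
equationAt r q k = (r k , q k , r (suc k) , r (suc (suc k)))

-- The last equation comes out in modified form exactly when r (m + 2) = r (m + 1).
sequence-chain : (r q : ℕ → ℕ) (m : ℕ) →
  (∀ k → k < suc (suc m) → r k ≡ q k * r (suc k) + r (suc (suc k))) →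
  (∀ k → suc (suc k) < suc (suc m) → r (suc (suc k)) < r (suc k)) →
  r (suc (suc (suc m))) ≡ 0 → 0 < r (suc (suc m)) → 0 < q (suc m) →
  EuclidChain (r 0) (r 1) (applyUpTo (equationAt r q) (suc (suc m)))
sequence-chain r q zero eqn _ r₃≡0 0<r₂ 0<q₁ = last-two (m≤n⇒m<n∨m≡n r₂≤r₁)
  where
  r₁≡ : r 1 ≡ q 1 * r 2
  r₁≡ = trans (eqn 1 (s≤s (s≤s z≤n))) (trans (cong (q 1 * r 2 +_) r₃≡0) (+-identityʳ _))
  r₂≤r₁ : r 2 ≤ r 1
  r₂≤r₁ = subst (r 2 ≤_) (sym r₁≡) (m≤n*m (r 2) (q 1) ⦃ >-nonZero 0<q₁ ⦄)
  q₁≡1 : r 2 ≡ r 1 → q 1 ≡ 1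
  q₁≡1 r₂≡r₁ = *-cancelʳ-≡ (q 1) 1 (r 2) ⦃ >-nonZero 0<r₂ ⦄ (trans (sym r₁≡) (trans (sym r₂≡r₁) (sym (*-identityˡ (r 2)))))
  last-two : r 2 < r 1 ⊎ r 2 ≡ r 1 → EuclidChain (r 0) (r 1) (applyUpTo (equationAt r q) 2)
  last-two (inj₁ r₂<r₁) rewrite r₃≡0 = step r₂<r₁ (eqn 0 (s≤s z≤n)) (done 0<r₂ r₁≡)
  last-two (inj₂ r₂≡r₁) rewrite sym r₂≡r₁ | r₃≡0 | q₁≡1 r₂≡r₁ =
    done-mod 0<r₂ (subst (λ x → r 0 ≡ q 0 * x + r 2) (sym r₂≡r₁) (eqn 0 (s≤s z≤n)))
sequence-chain r q (suc m) eqn dec r-end 0<r 0<q =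
  step (dec 0 (s≤s (s≤s (s≤s z≤n)))) (eqn 0 (s≤s z≤n))
    (sequence-chain (λ k → r (suc k)) (λ k → q (suc k)) m (λ k k< → eqn (suc k) (s≤s k<)) (λ k k< → dec (suc k) (s≤s k<))
                    r-end 0<r 0<q)

nth-++ˡ : ∀ xs ys {k} → k < length xs → nth (xs ++ ys) k ≡ nth xs k
nth-++ˡ (x ∷ xs) ys {zero}  _         = refl
nth-++ˡ (x ∷ xs) ys {suc k} (s≤s k<n) = nth-++ˡ xs ys k<n

nth-++ʳ : ∀ xs ys k → nth (xs ++ ys) (length xs + k) ≡ nth ys k
nth-++ʳ []       ys k = refl
nth-++ʳ (x ∷ xs) ys k = nth-++ʳ xs ys k

nth-applyUpTo : ∀ f {m k} → k < m → nth (applyUpTo f m) k ≡ f k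
nth-applyUpTo f {suc m} {zero}  _         = refl
nth-applyUpTo f {suc m} {suc k} (s≤s k<m) = nth-applyUpTo (λ i → f (suc i)) k<m

nth-applyDownFrom : ∀ f {m k} → k < m → nth (applyDownFrom f m) k ≡ f (m ∸ suc k)
nth-applyDownFrom f {suc m} {zero}  _         = refl
nth-applyDownFrom f {suc m} {suc k} (s≤s k<m) = nth-applyDownFrom f k<m

applyUpTo-+ : ∀ {A : Set} (f : ℕ → A) m n → applyUpTo f (m + n) ≡ applyUpTo f m ++ applyUpTo (λ i → f (m + i)) n
applyUpTo-+ f zero    n = refl
applyUpTo-+ f (suc m) n = cong (f 0 ∷_) (applyUpTo-+ (λ i → f (suc i)) m n)

applyUpTo-cong : ∀ {A : Set} {f g : ℕ → A} m → (∀ k → k < m → f k ≡ g k) → applyUpTo f m ≡ applyUpTo g m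
applyUpTo-cong zero    _   = refl
applyUpTo-cong (suc m) f≗g = cong₂ _∷_ (f≗g 0 (s≤s z≤n)) (applyUpTo-cong m (λ k k<m → f≗g (suc k) (s≤s k<m)))

module _ (s′ : ℕ) (q : ℕ → ℕ) where
  private
    ascending : List ℕ
    ascending = applyUpTo (λ k → q (suc k)) s′
    descending : List ℕ
    descending = applyDownFrom (λ k → q (suc k)) s′
    turn : List ℕ
    turn = (q (suc s′) + δ₁ (suc s′)) ∷ 1 ∷ (q (suc s′) + δ₀ (suc s′)) ∷ descending

    palQuotients-turn : ∀ j → nth (palQuotients (suc s′) q) (s′ + j) ≡ nth turn j
    palQuotients-turn j = subst (λ n → nth (ascending ++ turn) (n + j) ≡ nth turn j)
                            (length-applyUpTo _ s′) (nth-++ʳ ascending turn j)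

  length-palQuotients : length (palQuotients (suc s′) q) ≡ suc (2 * suc s′)
  length-palQuotients = begin
    length (ascending ++ turn)                 ≡⟨ length-++ ascending ⟩
    length ascending + suc (suc (suc (length descending)))
                                               ≡⟨ cong₂ (λ m n → m + suc (suc (suc n))) (length-applyUpTo _ s′) (length-applyDownFrom _ s′) ⟩
    s′ + suc (suc (suc s′))                    ≡⟨ solve (s′ ∷ []) ⟩
    suc (2 * suc s′)                           ∎
    where open ≡-Reasoning

  palQuotients-ascending : ∀ {k} → k < s′ → nth (palQuotients (suc s′) q) k ≡ q (suc k)
  palQuotients-ascending k<s′ =
    trans (nth-++ˡ ascending turn (subst (_ <_) (sym (length-applyUpTo _ s′)) k<s′)) (nth-applyUpTo _ k<s′)

  palQuotients-turn₁ : nth (palQuotients (suc s′) q) s′ ≡ q (suc s′) + δ₁ (suc s′)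
  palQuotients-turn₁ = trans (cong (nth (palQuotients (suc s′) q)) (sym (+-identityʳ s′))) (palQuotients-turn 0)

  palQuotients-turn₂ : nth (palQuotients (suc s′) q) (suc s′) ≡ 1
  palQuotients-turn₂ = trans (cong (nth (palQuotients (suc s′) q)) (+-comm 1 s′)) (palQuotients-turn 1)

  palQuotients-turn₃ : nth (palQuotients (suc s′) q) (suc (suc s′)) ≡ q (suc s′) + δ₀ (suc s′)
  palQuotients-turn₃ = trans (cong (nth (palQuotients (suc s′) q)) (+-comm 2 s′)) (palQuotients-turn 2)

  palQuotients-descending : ∀ {j} → j < s′ → nth (palQuotients (suc s′) q) (s′ + suc (suc (suc j))) ≡ q (s′ ∸ j)
  palQuotients-descending {j} j<s′ =
    trans (palQuotients-turn (suc (suc (suc j))))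
          (trans (nth-applyDownFrom _ j<s′) (cong q (sym (+-∸-assoc 1 j<s′))))

coprime-of-∣v²+v∸1 : ∀ {d u v} → 0 < v → d ∣ u → d ∣ v → u ∣ v * v + v ∸ 1 → d ≡ 1
coprime-of-∣v²+v∸1 {d} {u} {suc v} _ d∣u d∣v u∣ =
  ∣1⇒≡1 (∣m+n∣m⇒∣n (subst (d ∣_) v²+v≡ (∣m∣n⇒∣m+n (∣n⇒∣m*n (suc v) d∣v) d∣v)) (∣-trans d∣u u∣))
  where
  v²+v≡ : suc v * suc v + suc v ≡ (suc v * suc v + suc v ∸ 1) + 1
  v²+v≡ = sym (m∸n+n≡m (s≤s z≤n))

+-≤-of-eqn : ∀ {x A y z} → x ≡ A * y + z → 0 < A → y + z ≤ x
+-≤-of-eqn {A = suc A} {y} {z} x≡ _ = subst (y + z ≤_) (sym x≡) (+-monoˡ-≤ z (m≤m+n y (A * y)))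

antitone-from-step : (f : ℕ → ℕ) → (∀ n → f (suc n) ≤ f n) → ∀ {m n} → m ≤ n → f n ≤ f m
antitone-from-step f f↓ {n = zero}  z≤n       = ≤-refl
antitone-from-step f f↓ {n = suc n} z≤n       = ≤-trans (f↓ n) (antitone-from-step f f↓ z≤n)
antitone-from-step f f↓             (s≤s m≤n) = antitone-from-step (λ i → f (suc i)) (λ i → f↓ (suc i)) m≤n

≤ᵇ-true : ∀ {m n} → m ≤ n → (m ≤ᵇ n) ≡ true
≤ᵇ-true m≤n = Equivalence.to T-≡ (≤⇒≤ᵇ m≤n)

≤ᵇ-false : ∀ {m n} → n < m → (m ≤ᵇ n) ≡ false
≤ᵇ-false {m} {n} n<m = ¬-not (λ m≤ᵇn → <⇒≱ n<m (≤ᵇ⇒≤ m n (Equivalence.from T-≡ m≤ᵇn)))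

Eqn-≡ : ∀ {a a′ q q′ b b′ r r′} → a ≡ a′ → q ≡ q′ → b ≡ b′ → r ≡ r′ → _≡_ {A = Eqn} (a , q , b , r) (a′ , q′ , b′ , r′)
Eqn-≡ refl refl refl refl = refl

-- If x and y satisfy the same three-term recurrence, read in opposite directions,
-- then x + y and x ∸ y alternate through it.
recurrence-+ : ∀ {Q x₀ x₁ x₂ y₀ y₁ y₂} → x₀ ≡ Q * x₁ + x₂ → y₂ ≡ Q * y₁ + y₀ → y₁ ≤ x₁ →
  x₀ + y₀ ≡ Q * (x₁ ∸ y₁) + (x₂ + y₂)
recurrence-+ {Q} {x₀} {x₁} {x₂} {y₀} {y₁} {y₂} x₀≡ y₂≡ y₁≤x₁ = begin
  x₀ + y₀                           ≡⟨ cong (_+ y₀) x₀≡ ⟩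
  Q * x₁ + x₂ + y₀                  ≡⟨ cong (λ x → Q * x + x₂ + y₀) (m∸n+n≡m y₁≤x₁) ⟨
  Q * (x₁ ∸ y₁ + y₁) + x₂ + y₀      ≡⟨ regroup Q (x₁ ∸ y₁) y₁ x₂ y₀ ⟩
  Q * (x₁ ∸ y₁) + (x₂ + (Q * y₁ + y₀)) ≡⟨ cong (λ y → Q * (x₁ ∸ y₁) + (x₂ + y)) y₂≡ ⟨
  Q * (x₁ ∸ y₁) + (x₂ + y₂)         ∎
  where
  open ≡-Reasoning
  regroup : ∀ Q t y₁ x₂ y₀ → Q * (t + y₁) + x₂ + y₀ ≡ Q * t + (x₂ + (Q * y₁ + y₀))
  regroup = solve-∀

recurrence-∸ : ∀ {Q x₀ x₁ x₂ y₀ y₁ y₂} → x₀ ≡ Q * x₁ + x₂ → y₂ ≡ Q * y₁ + y₀ → y₀ ≤ x₀ → y₂ ≤ x₂ →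
  x₀ ∸ y₀ ≡ Q * (x₁ + y₁) + (x₂ ∸ y₂)
recurrence-∸ {Q} {x₀} {x₁} {x₂} {y₀} {y₁} {y₂} x₀≡ y₂≡ y₀≤x₀ y₂≤x₂ = +-cancelʳ-≡ y₀ _ _ (begin
  x₀ ∸ y₀ + y₀                       ≡⟨ m∸n+n≡m y₀≤x₀ ⟩
  x₀                                 ≡⟨ x₀≡ ⟩
  Q * x₁ + x₂                        ≡⟨ cong (Q * x₁ +_) (m∸n+n≡m y₂≤x₂) ⟨
  Q * x₁ + (x₂ ∸ y₂ + y₂)            ≡⟨ cong (λ y → Q * x₁ + (x₂ ∸ y₂ + y)) y₂≡ ⟩
  Q * x₁ + (x₂ ∸ y₂ + (Q * y₁ + y₀)) ≡⟨ regroup Q x₁ y₁ (x₂ ∸ y₂) y₀ ⟩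
  Q * (x₁ + y₁) + (x₂ ∸ y₂) + y₀     ∎)
  where
  open ≡-Reasoning
  regroup : ∀ Q x₁ y₁ t y₀ → Q * x₁ + (t + (Q * y₁ + y₀)) ≡ Q * (x₁ + y₁) + t + y₀
  regroup = solve-∀

turn-odd : ∀ {Q xₘ x₁ a b} → x₁ ≡ Q * a + b → xₘ ≡ (Q + 1) * (x₁ + a) + x₁ → xₘ + b ≡ (Q + 3) * x₁ + a
turn-odd {Q} {a = a} {b} refl refl = solve (Q ∷ a ∷ b ∷ [])

turn-even : ∀ {Q xₘ x₀ x₁ a b} → x₁ ≡ (Q + 1) * a + b → x₀ ≡ x₁ + a → xₘ ≡ Q * x₀ + x₁ →
  xₘ ∸ b ≡ Q * (x₀ + a) + a × x₀ + a ≡ (Q + 3) * a + b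
turn-even {Q} {a = a} {b} refl refl refl =
  trans (cong (_∸ b) (regroup Q a b)) (m+n∸n≡m _ b) , solve (Q ∷ a ∷ b ∷ [])
  where
  regroup : ∀ Q a b → Q * ((Q + 1) * a + b + a) + ((Q + 1) * a + b) ≡ Q * ((Q + 1) * a + b + a + a) + a + b
  regroup = solve-∀

turn-even-< : ∀ {Q xₘ x₀ x₁ a b} → 0 < Q → 0 < a → x₁ ≡ (Q + 1) * a + b → xₘ ≡ Q * x₀ + x₁ → x₀ + a + b < xₘ
turn-even-< {suc Q} {x₀ = x₀} {a = suc a} {b} _ _ refl refl =
  subst (x₀ + suc a + b <_) (regroup Q x₀ a b) (m≤m+n (suc (x₀ + suc a + b)) (Q * x₀ + Q * a + a + Q))
  where
  regroup : ∀ Q x₀ a b → suc (x₀ + suc a + b) + (Q * x₀ + Q * a + a + Q) ≡ suc Q * x₀ + ((suc Q + 1) * suc a + b)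
  regroup = solve-∀

mirror-index : ∀ {s′ k} → k < s′ →
  ∃[ j ] j < s′ × s′ ∸ j ≡ suc k × suc (suc k) + (s′ + suc (suc (suc j))) ≡ 2 * suc s′ + 2
mirror-index {k = k} k<s′ with m≤n⇒∃[o]m+o≡n k<s′
... | j , refl = j , s≤s (m≤n+m j k) , m+n∸n≡m (suc k) j , solve (k ∷ j ∷ [])

descending-index : ∀ {s′ k} → suc s′ < k → k < 2 * suc s′ →
  ∃[ j ] j < s′ × suc k ≡ s′ + suc (suc (suc j)) × 2 * suc s′ ∸ k ≡ s′ ∸ j
descending-index {s′} s<k k<2s with m≤n⇒∃[o]m+o≡n s<k
... | j , refl =
  j ,
  +-cancelˡ-≤ (suc (suc s′)) _ _ (subst₂ _≤_ (sym (+-suc (suc (suc s′)) j)) 2s≡ k<2s) ,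
  solve (s′ ∷ j ∷ []) ,
  trans (cong (_∸ (suc (suc s′) + j)) 2s≡) ([m+n]∸[m+o]≡n∸o (suc (suc s′)) s′ j)
  where
  2s≡ : 2 * suc s′ ≡ suc (suc s′) + s′
  2s≡ = solve (s′ ∷ [])

mirror-< : ∀ {j n} → j ≤ n → j < 2 * n + 2 ∸ j
mirror-< {j} {n} j≤n =
  m+n≤o⇒m≤o∸n (suc j) (≤-trans (+-mono-≤ (s≤s j≤n) j≤n) (≤-trans (n≤1+n (suc n + n)) (≤-reflexive (solve (n ∷ [])))))

mirror-≤ : ∀ {j n} → 2 ≤ j → 2 * n + 2 ∸ j ≤ 2 * n
mirror-≤ {n = n} 2≤j = ≤-trans (∸-monoʳ-≤ (2 * n + 2) 2≤j) (≤-reflexive (m+n∸n≡m (2 * n) 2))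

module PalindromicRun (u v s′ : ℕ) (q : ℕ → ℕ) (0<v : 0 < v) (v<u : v < u) (u∣ : u ∣ v * v + v ∸ 1)
                (q-pos : ∀ i → 1 ≤ i → i ≤ suc s′ → 1 ≤ q i)
                (quotients≡ : quotients (EA u v 1) ≡ palQuotients (suc s′) q) where

  s : ℕ
  s = suc s′

  Q : ℕ
  Q = q s

  r : ℕ → ℕ
  r = R u v

  A : ℕ → ℕ
  A = nth (palQuotients s q)

  τ : ℕ → ℕ
  τ = T u v s

  private
    run-chain : EuclidChain u v (EA u v 1)
    run-chain = EA-chain u v 1 0<v v<u

    length-run : length (EA u v 1) ≡ suc (2 * s)
    length-run = trans (sym (length-map quotient (EA u v 1))) (trans (cong length quotients≡) (length-palQuotients s′ q))

    in-run : ∀ {k} → k ≤ 2 * s → k < length (EA u v 1)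
    in-run k≤2s = subst (_ <_) (sym length-run) (s≤s k≤2s)

  r-eqn : ∀ {k} → k ≤ 2 * s → r k ≡ A k * r (suc k) + r (suc (suc k))
  r-eqn {k} k≤2s = trans (chain-eqn run-chain k (in-run k≤2s))
                         (cong (λ a → nth a k * r (suc k) + r (suc (suc k))) quotients≡)

  r-step-< : ∀ {j} → suc j ≤ 2 * s → r (suc j) < r j
  r-step-< {zero}  _      = v<u
  r-step-< {suc j} 2+j≤2s = chain-remainder-< run-chain j (in-run 2+j≤2s)

  r-antitone : ∀ {i j} → i ≤ j → r j ≤ r i
  r-antitone = antitone-from-step r r-step-≤
    where
    r-step-≤ : ∀ j → r (suc j) ≤ r j
    r-step-≤ zero    = <⇒≤ v<u
    r-step-≤ (suc j) = chain-remainder-≤ run-chain j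

  r-strict : ∀ {i j} → i < j → j ≤ 2 * s → r j < r i
  r-strict {i} {suc j} (s≤s i≤j) j<2s = <-≤-trans (r-step-< j<2s) (r-antitone i≤j)

  r-end : r (suc (suc (2 * s))) ≡ 0
  r-end = subst (λ n → r (suc n) ≡ 0) length-run (chain-remainder-end run-chain)

  -- The last non-zero remainder is gcd(u, v), and the congruence makes u and v coprime.
  r-last : r (suc (2 * s)) ≡ 1
  r-last = subst (λ n → r n ≡ 1) length-run
             (coprime-of-∣v²+v∸1 0<v (proj₁ (chain-gcd run-chain)) (proj₂ (chain-gcd run-chain)) u∣)

  r-pos : ∀ {j} → j ≤ suc (2 * s) → 0 < r j
  r-pos {j} j≤ = subst (_≤ r j) r-last (r-antitone j≤)

  -- In the paper's indexing r j = r_{j-1} and r̄ j = r_{2s+1-j}.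
  r̄ : ℕ → ℕ
  r̄ j = r (2 * s + 2 ∸ j)

  r̄-at : ∀ j d → j + d ≡ 2 * s + 2 → r̄ j ≡ r d
  r̄-at j d j+d≡ = cong r (trans (cong (_∸ j) (sym j+d≡)) (m+n∸m≡n j d))

  r̄≤r : ∀ {j} → j ≤ s → r̄ j ≤ r j
  r̄≤r j≤s = r-antitone (<⇒≤ (mirror-< j≤s))

  r̄-eqn : ∀ {k d} → suc (suc k) + d ≡ 2 * s + 2 → r̄ (suc (suc k)) ≡ A d * r̄ (suc k) + r̄ k
  r̄-eqn {k} {d} k+d≡ = begin
    r̄ (suc (suc k))               ≡⟨ r̄-at (suc (suc k)) d k+d≡ ⟩
    r d                           ≡⟨ r-eqn d≤2s ⟩
    A d * r (suc d) + r (suc (suc d)) ≡⟨ cong₂ (λ x y → A d * x + y) (r̄-at (suc k) (suc d) (trans (+-suc (suc k) d) k+d≡))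
                                                                   (r̄-at k (suc (suc d)) (trans (+-suc k (suc d)) (trans (cong suc (+-suc k d)) k+d≡))) ⟨
    A d * r̄ (suc k) + r̄ k         ∎
    where
    open ≡-Reasoning
    d≤2s : d ≤ 2 * s
    d≤2s = +-cancelʳ-≤ 2 d (2 * s) (subst₂ _≤_ (+-comm 2 d) k+d≡ (s≤s (s≤s (m≤n+m d k))))

  τ-even : ∀ j → j % 2 ≡ 0 → τ j ≡ r j + r̄ j
  τ-even j j-even rewrite j-even = refl

  τ-odd : ∀ j → j % 2 ≡ 1 → τ j ≡ r j ∸ r̄ j
  τ-odd j j-odd rewrite j-odd = refl

  ≤2s : ∀ {k} → k ≤ s → k ≤ 2 * s
  ≤2s k≤s = ≤-trans k≤s (m≤m+n s (s + 0))

  r̄<r : ∀ {j} → 2 ≤ j → j ≤ s → r̄ j < r j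
  r̄<r 2≤j j≤s = r-strict (mirror-< j≤s) (mirror-≤ {n = s} 2≤j)

  r̄-recurrence : ∀ {k} → k < s′ → r̄ (suc (suc k)) ≡ q (suc k) * r̄ (suc k) + r̄ k
  r̄-recurrence {k} k<s′ with mirror-index k<s′
  ... | j , j<s′ , s′∸j≡ , k+d≡ =
    trans (r̄-eqn k+d≡) (cong (λ a → a * r̄ (suc k) + r̄ k) (trans (palQuotients-descending s′ q j<s′) (cong q s′∸j≡)))

  r-ascending : ∀ {k} → k < s′ → r k ≡ q (suc k) * r (suc k) + r (suc (suc k))
  r-ascending {k} k<s′ = trans (r-eqn (≤2s (≤-trans (<⇒≤ k<s′) (n≤1+n s′))))
                               (cong (λ a → a * r (suc k) + r (suc (suc k))) (palQuotients-ascending s′ q k<s′))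

  τ-recurrence : ∀ {k} → k < s′ → τ k ≡ q (suc k) * τ (suc k) + τ (suc (suc k))
  τ-recurrence {k} k<s′ with parity k
  ... | inj₁ (k-even , k+1-odd) = begin
    τ k                                ≡⟨ τ-even k k-even ⟩
    r k + r̄ k                          ≡⟨ recurrence-+ {q (suc k)} (r-ascending k<s′) (r̄-recurrence k<s′) (r̄≤r (s≤s (<⇒≤ k<s′))) ⟩
    q (suc k) * (r (suc k) ∸ r̄ (suc k)) + (r (suc (suc k)) + r̄ (suc (suc k)))
                                       ≡⟨ cong₂ (λ x y → q (suc k) * x + y) (τ-odd (suc k) k+1-odd)
                                                (τ-even (suc (suc k)) (trans (%2-suc-suc k) k-even)) ⟨
    q (suc k) * τ (suc k) + τ (suc (suc k)) ∎
    where open ≡-Reasoning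
  ... | inj₂ (k-odd , k+1-even) = begin
    τ k                                ≡⟨ τ-odd k k-odd ⟩
    r k ∸ r̄ k                          ≡⟨ recurrence-∸ {q (suc k)} (r-ascending k<s′) (r̄-recurrence k<s′)
                                                       (r̄≤r (≤-trans (<⇒≤ k<s′) (n≤1+n s′))) (r̄≤r (s≤s k<s′)) ⟩
    q (suc k) * (r (suc k) + r̄ (suc k)) + (r (suc (suc k)) ∸ r̄ (suc (suc k)))
                                       ≡⟨ cong₂ (λ x y → q (suc k) * x + y) (τ-even (suc k) k+1-even)
                                                (τ-odd (suc (suc k)) (trans (%2-suc-suc k) k-odd)) ⟨
    q (suc k) * τ (suc k) + τ (suc (suc k)) ∎
    where open ≡-Reasoning

  s+s≡2s : s + s ≡ 2 * s
  s+s≡2s = cong (s +_) (sym (+-identityʳ s))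

  s<2s : s < 2 * s
  s<2s = subst (s <_) s+s≡2s (m<m+n s (s≤s z≤n))

  2+s≤2s : 1 ≤ s′ → suc (suc s) ≤ 2 * s
  2+s≤2s 1≤s′ = subst (suc (suc s) ≤_) s+s≡2s (subst (_≤ s + s) (+-comm s 2) (+-monoʳ-≤ s (s≤s 1≤s′)))

  module Turn where
    xₘ x₀ x₁ a b : ℕ
    xₘ = r s′
    x₀ = r s
    x₁ = r (suc s)
    a  = r (suc (suc s))
    b  = r (suc (suc (suc s)))

    r̄-s : r̄ s ≡ a
    r̄-s = r̄-at s (suc (suc s)) (index s′)
      where
      index : ∀ n → suc n + suc (suc (suc n)) ≡ 2 * suc n + 2
      index = solve-∀

    r̄-s′ : r̄ s′ ≡ b
    r̄-s′ = r̄-at s′ (suc (suc (suc s))) (index s′)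
      where
      index : ∀ n → n + suc (suc (suc (suc n))) ≡ 2 * suc n + 2
      index = solve-∀

    xₘ≡ : xₘ ≡ (Q + δ₁ s) * x₀ + x₁
    xₘ≡ = trans (r-eqn (≤2s (n≤1+n s′))) (cong (λ c → c * x₀ + x₁) (palQuotients-turn₁ s′ q))

    x₀≡ : x₀ ≡ x₁ + a
    x₀≡ = trans (r-eqn (≤2s ≤-refl))
                (trans (cong (λ c → c * x₁ + a) (palQuotients-turn₂ s′ q)) (cong (_+ a) (*-identityˡ x₁)))

    x₁≡ : x₁ ≡ (Q + δ₀ s) * a + b
    x₁≡ = trans (r-eqn s<2s) (cong (λ c → c * a + b) (palQuotients-turn₃ s′ q))

    Q+0≡Q : Q + 0 ≡ Q
    Q+0≡Q = +-identityʳ Q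

    τs-odd : s % 2 ≡ 1 → τ s ≡ x₁
    τs-odd s-odd = trans (τ-odd s s-odd) (trans (cong₂ _∸_ x₀≡ r̄-s) (m+n∸n≡m x₁ a))

    τs-even : s % 2 ≡ 0 → τ s ≡ x₀ + a
    τs-even s-even = trans (τ-even s s-even) (cong (x₀ +_) r̄-s)

    x₁≡-even : s % 2 ≡ 0 → x₁ ≡ (Q + 1) * a + b
    x₁≡-even s-even = trans x₁≡ (cong (λ c → (Q + c) * a + b) (cong (1 ∸_) s-even))

    x₁≡-odd : s % 2 ≡ 1 → x₁ ≡ Q * a + b
    x₁≡-odd s-odd = trans x₁≡ (trans (cong (λ c → (Q + c) * a + b) (cong (1 ∸_) s-odd)) (cong (λ c → c * a + b) Q+0≡Q))

    xₘ≡-odd : s % 2 ≡ 1 → xₘ ≡ (Q + 1) * (x₁ + a) + x₁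
    xₘ≡-odd s-odd = trans xₘ≡ (cong₂ (λ d x → (Q + d) * x + x₁) s-odd x₀≡)

    xₘ≡-even : s % 2 ≡ 0 → xₘ ≡ Q * x₀ + x₁
    xₘ≡-even s-even = trans xₘ≡ (trans (cong (λ c → (Q + c) * x₀ + x₁) s-even) (cong (λ c → c * x₀ + x₁) Q+0≡Q))

    odd-eqns : s′ % 2 ≡ 0 → s % 2 ≡ 1 → τ s′ ≡ (Q + 3 * δ₁ s) * τ s + a × τ s ≡ (Q + 3 * δ₀ s) * a + b
    odd-eqns s′-even s-odd = eqn₁ , eqn₂
      where
      open ≡-Reasoning
      eqn₁ : τ s′ ≡ (Q + 3 * δ₁ s) * τ s + a
      eqn₁ = begin
        τ s′                    ≡⟨ τ-even s′ s′-even ⟩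
        xₘ + r̄ s′               ≡⟨ cong (xₘ +_) r̄-s′ ⟩
        xₘ + b                  ≡⟨ turn-odd {Q} {a = a} (x₁≡-odd s-odd) (xₘ≡-odd s-odd) ⟩
        (Q + 3) * x₁ + a        ≡⟨ cong₂ (λ d x → (Q + 3 * d) * x + a) s-odd (τs-odd s-odd) ⟨
        (Q + 3 * δ₁ s) * τ s + a ∎
      eqn₂ : τ s ≡ (Q + 3 * δ₀ s) * a + b
      eqn₂ = trans (τs-odd s-odd) (trans x₁≡ (cong (λ c → (Q + c) * a + b) (trans δ₀≡0 (sym (cong (3 *_) δ₀≡0)))))
        where
        δ₀≡0 : δ₀ s ≡ 0
        δ₀≡0 = cong (1 ∸_) s-odd

    even-eqns : s′ % 2 ≡ 1 → s % 2 ≡ 0 → τ s′ ≡ (Q + 3 * δ₁ s) * τ s + a × τ s ≡ (Q + 3 * δ₀ s) * a + b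
    even-eqns s′-odd s-even = eqn₁ , eqn₂
      where
      open ≡-Reasoning
      arith : xₘ ∸ b ≡ Q * (x₀ + a) + a × x₀ + a ≡ (Q + 3) * a + b
      arith = turn-even {Q} {a = a} (x₁≡-even s-even) x₀≡ (xₘ≡-even s-even)
      eqn₁ : τ s′ ≡ (Q + 3 * δ₁ s) * τ s + a
      eqn₁ = begin
        τ s′                     ≡⟨ τ-odd s′ s′-odd ⟩
        xₘ ∸ r̄ s′                ≡⟨ cong (xₘ ∸_) r̄-s′ ⟩
        xₘ ∸ b                   ≡⟨ proj₁ arith ⟩
        Q * (x₀ + a) + a         ≡⟨ cong₂ (λ c x → c * x + a) (trans (cong (λ d → Q + 3 * d) s-even) Q+0≡Q) (τs-even s-even) ⟨
        (Q + 3 * δ₁ s) * τ s + a ∎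
      eqn₂ : τ s ≡ (Q + 3 * δ₀ s) * a + b
      eqn₂ = begin
        τ s                      ≡⟨ τs-even s-even ⟩
        x₀ + a                   ≡⟨ proj₂ arith ⟩
        (Q + 3) * a + b          ≡⟨ cong (λ d → (Q + 3 * (1 ∸ d)) * a + b) s-even ⟨
        (Q + 3 * δ₀ s) * a + b   ∎

    r+r̄+r̄<r : s % 2 ≡ 0 → x₀ + r̄ s + r̄ s′ < xₘ
    r+r̄+r̄<r s-even = subst₂ (λ y z → x₀ + y + z < xₘ) (sym r̄-s) (sym r̄-s′)
      (turn-even-< (q-pos s (s≤s z≤n) ≤-refl) (r-pos (s≤s s<2s)) (x₁≡-even s-even) (xₘ≡-even s-even))

    a<τs : 1 ≤ s′ → a < τ s
    a<τs 1≤s′ with parity s′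
    ... | inj₁ (_ , s-odd)  = subst (a <_) (sym (τs-odd s-odd)) (r-step-< (2+s≤2s 1≤s′))
    ... | inj₂ (_ , s-even) = subst (a <_) (sym (τs-even s-even)) (m<n+m a (r-pos (≤-trans (≤2s ≤-refl) (n≤1+n (2 * s)))))

  turn-eqns : τ s′ ≡ (Q + 3 * δ₁ s) * τ s + r (suc (suc s))
            × τ s ≡ (Q + 3 * δ₀ s) * r (suc (suc s)) + r (suc (suc (suc s)))
  turn-eqns with parity s′
  ... | inj₁ (s′-even , s-odd) = Turn.odd-eqns s′-even s-odd
  ... | inj₂ (s′-odd , s-even) = Turn.even-eqns s′-odd s-even

  r-descending : ∀ {k} → s < k → k < 2 * s → r (suc k) ≡ q (2 * s ∸ k) * r (suc (suc k)) + r (suc (suc (suc k)))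
  r-descending {k} s<k k<2s with descending-index s<k k<2s
  ... | j , j<s′ , 1+k≡ , 2s∸k≡ =
    trans (r-eqn k<2s) (cong (λ c → c * r (suc (suc k)) + r (suc (suc (suc k))))
                             (trans (cong A 1+k≡) (trans (palQuotients-descending s′ q j<s′) (cong q (sym 2s∸k≡)))))

  r+r̄+r̄<r : ∀ {k} → suc k < s′ → r (suc (suc k)) + r̄ (suc (suc k)) + r̄ (suc k) < r (suc k)
  r+r̄+r̄<r {k} 1+k<s′ = begin-strict
    r (suc (suc k)) + r̄ (suc (suc k)) + r̄ (suc k)   ≡⟨ +-assoc (r (suc (suc k))) _ _ ⟩
    r (suc (suc k)) + (r̄ (suc (suc k)) + r̄ (suc k)) ≤⟨ +-monoʳ-≤ (r (suc (suc k))) (+-≤-of-eqn (r̄-recurrence 1+k<s′) q₂₊ₖ-pos) ⟩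
    r (suc (suc k)) + r̄ (suc (suc (suc k)))         <⟨ +-monoʳ-< (r (suc (suc k))) (r̄<r (s≤s (s≤s z≤n)) (s≤s 1+k<s′)) ⟩
    r (suc (suc k)) + r (suc (suc (suc k)))         ≤⟨ +-≤-of-eqn (r-ascending 1+k<s′) q₂₊ₖ-pos ⟩
    r (suc k)                                       ∎
    where
    open ≤-Reasoning
    q₂₊ₖ-pos : 0 < q (suc (suc k))
    q₂₊ₖ-pos = q-pos (suc (suc k)) (s≤s z≤n) (≤-trans 1+k<s′ (n≤1+n s′))

  τ-decreasing : ∀ {k} → suc (suc k) ≤ s → τ (suc (suc k)) < τ (suc k)
  τ-decreasing {k} 2+k≤s with parity (suc k)
  ... | inj₁ (k+1-even , k+2-odd) = begin-strict
    τ (suc (suc k))                   ≡⟨ τ-odd (suc (suc k)) k+2-odd ⟩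
    r (suc (suc k)) ∸ r̄ (suc (suc k)) ≤⟨ m∸n≤m (r (suc (suc k))) (r̄ (suc (suc k))) ⟩
    r (suc (suc k))                   <⟨ r-step-< (≤2s 2+k≤s) ⟩
    r (suc k)                         ≤⟨ m≤m+n (r (suc k)) (r̄ (suc k)) ⟩
    r (suc k) + r̄ (suc k)             ≡⟨ τ-even (suc k) k+1-even ⟨
    τ (suc k)                         ∎
    where open ≤-Reasoning
  ... | inj₂ (k+1-odd , k+2-even) =
    subst₂ _<_ (sym (τ-even (suc (suc k)) k+2-even)) (sym (τ-odd (suc k) k+1-odd))
           (m+n≤o⇒m≤o∸n (suc (r (suc (suc k)) + r̄ (suc (suc k)))) (key (m≤n⇒m<n∨m≡n 2+k≤s)))
    where
    key : suc (suc k) < s ⊎ suc (suc k) ≡ s → r (suc (suc k)) + r̄ (suc (suc k)) + r̄ (suc k) < r (suc k)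
    key (inj₁ 2+k<s) = r+r̄+r̄<r (≤-pred 2+k<s)
    key (inj₂ 2+k≡s) = subst (λ z → r (suc z) + r̄ (suc z) + r̄ z < r z) (sym (suc-injective 2+k≡s))
                             (Turn.r+r̄+r̄<r (subst (λ z → z % 2 ≡ 0) 2+k≡s k+2-even))

  -- The remainders and quotients of the claimed run, indexed like r and A.
  t : ℕ → ℕ
  t k = if k ≤ᵇ s then τ k else r (suc k)

  c : ℕ → ℕ
  c k = if suc k ≤ᵇ s′ then q (suc k)
        else if k ≤ᵇ s′ then Q + 3 * δ₁ s
        else if k ≤ᵇ s then Q + 3 * δ₀ s
        else q (2 * s ∸ k)

  t-≤ : ∀ {k} → k ≤ s → t k ≡ τ k
  t-≤ k≤s rewrite ≤ᵇ-true k≤s = refl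

  t-> : ∀ {k} → s < k → t k ≡ r (suc k)
  t-> s<k rewrite ≤ᵇ-false s<k = refl

  c-< : ∀ {k} → k < s′ → c k ≡ q (suc k)
  c-< k<s′ rewrite ≤ᵇ-true k<s′ = refl

  c-s′ : c s′ ≡ Q + 3 * δ₁ s
  c-s′ rewrite ≤ᵇ-false (n<1+n s′) | ≤ᵇ-true (≤-refl {s′}) = refl

  c-s : c s ≡ Q + 3 * δ₀ s
  c-s rewrite ≤ᵇ-false (≤-trans (n<1+n s′) (n≤1+n s)) | ≤ᵇ-false (n<1+n s′) | ≤ᵇ-true (≤-refl {s}) = refl

  c-> : ∀ {k} → s < k → c k ≡ q (2 * s ∸ k)
  c-> {k} s<k rewrite ≤ᵇ-false {suc k} {s′} (≤-trans (<⇒≤ s<k) (n≤1+n k)) | ≤ᵇ-false (<-trans (n<1+n s′) s<k) | ≤ᵇ-false s<k = refl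

  t-eqn : ∀ {k} → k < 2 * s → t k ≡ c k * t (suc k) + t (suc (suc k))
  t-eqn {k} k<2s with <-cmp k s′
  ... | tri< k<s′ _ _
    rewrite t-≤ (≤-trans (n≤1+n k) (s≤s (<⇒≤ k<s′))) | t-≤ (s≤s (<⇒≤ k<s′)) | t-≤ (s≤s k<s′) | c-< k<s′
    = τ-recurrence k<s′
  ... | tri≈ _ refl _
    rewrite t-≤ (n≤1+n s′) | t-≤ (≤-refl {s}) | t-> (n<1+n s) | c-s′
    = proj₁ turn-eqns
  ... | tri> _ _ s′<k with m≤n⇒m<n∨m≡n s′<k
  ...   | inj₂ refl
    rewrite t-≤ (≤-refl {s}) | t-> (n<1+n s) | t-> (≤-trans (n<1+n s) (n≤1+n (suc s))) | c-s
    = proj₂ turn-eqns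
  ...   | inj₁ s<k
    rewrite t-> s<k | t-> (≤-trans s<k (n≤1+n k)) | t-> (≤-trans s<k (≤-trans (n≤1+n k) (n≤1+n (suc k)))) | c-> s<k
    = r-descending s<k k<2s

  t-decreasing : ∀ {k} → suc (suc k) < 2 * s → t (suc (suc k)) < t (suc k)
  t-decreasing {k} 2+k<2s with <-cmp k s′
  ... | tri< k<s′ _ _ rewrite t-≤ (s≤s k<s′) | t-≤ (s≤s (<⇒≤ k<s′)) = τ-decreasing (s≤s k<s′)
  ... | tri≈ _ refl _ rewrite t-> (n<1+n s) | t-≤ (≤-refl {s}) = Turn.a<τs 1≤s′
    where
    1≤s′ : 1 ≤ s′
    1≤s′ = ≤-pred (+-cancelˡ-≤ s 2 s (subst₂ _≤_ (+-comm 2 s) (sym s+s≡2s) 2+k<2s))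
  ... | tri> _ _ s′<k rewrite t-> (s≤s (≤-trans s′<k (n≤1+n k))) | t-> (s≤s s′<k) = r-step-< 2+k<2s

  2s≡ : 2 * s ≡ suc (suc (s′ + s′))
  2s≡ = double s′
    where
    double : ∀ n → 2 * suc n ≡ suc (suc (n + n))
    double = solve-∀

  c-last-pos : 0 < c (suc (s′ + s′))
  c-last-pos with m≤n⇒m<n∨m≡n (z≤n {s′})
  ... | inj₁ 0<s′ = subst (0 <_) (sym (c-> (s≤s (m<m+n s′ 0<s′))))
                      (subst (λ n → 0 < q n) (sym (trans (cong (_∸ suc (s′ + s′)) 2s≡) (m+n∸n≡m 1 (s′ + s′))))
                             (q-pos 1 ≤-refl (s≤s z≤n)))
  ... | inj₂ 0≡s′ = subst (λ n → 0 < c (suc n)) (sym (trans (cong (s′ +_) (sym 0≡s′)) (+-identityʳ s′)))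
                      (subst (0 <_) (sym c-s) (≤-trans (q-pos s (s≤s z≤n) ≤-refl) (m≤m+n Q _)))

  new-run : List Eqn
  new-run = applyUpTo (equationAt t c) (2 * s)

  new-run-chain : EuclidChain (t 0) (t 1) new-run
  new-run-chain = subst (λ n → EuclidChain (t 0) (t 1) (applyUpTo (equationAt t c) n)) (sym 2s≡)
    (sequence-chain t c (s′ + s′) (λ k k< → t-eqn (within k<)) (λ k k< → t-decreasing (within k<))
                    (subst (λ n → t (suc n) ≡ 0) 2s≡ t-end) (subst (λ n → 0 < t n) 2s≡ t-last)
                    c-last-pos)
    where
    within : ∀ {k} → k < suc (suc (s′ + s′)) → k < 2 * s
    within {k} = subst (k <_) (sym 2s≡)
    t-end : t (suc (2 * s)) ≡ 0
    t-end = trans (t-> (≤-trans s<2s (n≤1+n (2 * s)))) r-end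
    t-last : 0 < t (2 * s)
    t-last = subst (0 <_) (sym (trans (t-> s<2s) r-last)) (s≤s z≤n)
  t0≡u : t 0 ≡ u
  t0≡u = begin
    t 0        ≡⟨ t-≤ z≤n ⟩
    τ 0        ≡⟨ τ-even 0 refl ⟩
    u + r̄ 0    ≡⟨ cong (u +_) (trans (r̄-at 0 (suc (suc (2 * s))) (+-comm 2 (2 * s))) r-end) ⟩
    u + 0      ≡⟨ +-identityʳ u ⟩
    u          ∎
    where open ≡-Reasoning

  t1≡v∸1 : t 1 ≡ v ∸ 1
  t1≡v∸1 = begin
    t 1        ≡⟨ t-≤ (s≤s z≤n) ⟩
    τ 1        ≡⟨ τ-odd 1 refl ⟩
    v ∸ r̄ 1    ≡⟨ cong (v ∸_) (trans (r̄-at 1 (suc (2 * s)) (+-comm 2 (2 * s))) r-last) ⟩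
    v ∸ 1      ∎
    where open ≡-Reasoning

  new-run-even : length new-run % 2 ≡ 0
  new-run-even = trans (cong (_% 2) (trans (length-applyUpTo (equationAt t c) (2 * s)) (*-comm 2 s))) (m*n%n≡0 s 2)

  new-run-ascending : ∀ k → k < s′ → equationAt t c k ≡ (τ (suc k ∸ 1) , q (suc k) , τ (suc k) , τ (suc (suc k)))
  new-run-ascending k k<s′ =
    Eqn-≡ (t-≤ (≤-trans (n≤1+n k) (s≤s (<⇒≤ k<s′)))) (c-< k<s′) (t-≤ (s≤s (<⇒≤ k<s′))) (t-≤ (s≤s k<s′))

  new-run-turn₁ : equationAt t c (s′ + 0) ≡ (τ s′ , Q + 3 * δ₁ s , τ s , r (s + 2))
  new-run-turn₁ = trans (cong (equationAt t c) (+-identityʳ s′))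
    (Eqn-≡ (t-≤ (n≤1+n s′)) c-s′ (t-≤ ≤-refl) (trans (t-> (n<1+n s)) (cong r (+-comm 2 s))))

  new-run-turn₂ : equationAt t c (s′ + 1) ≡ (τ s , Q + 3 * δ₀ s , r (s + 2) , r (s + 3))
  new-run-turn₂ = trans (cong (equationAt t c) (+-comm s′ 1))
    (Eqn-≡ (t-≤ ≤-refl) c-s (trans (t-> (n<1+n s)) (cong r (+-comm 2 s)))
           (trans (t-> (≤-trans (n<1+n s) (n≤1+n (suc s)))) (cong r (+-comm 3 s))))

  new-run-descending : ∀ i → i < s′ → equationAt t c (s′ + suc (suc i)) ≡
    (r (i + (s + 2)) , q (2 * s + 1 ∸ (i + (s + 2))) , r (suc (i + (s + 2))) , r (suc (suc (i + (s + 2)))))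
  new-run-descending i _ =
    Eqn-≡ (trans (t-> s<k) (cong r index)) (trans (c-> s<k) (cong q (cong₂ _∸_ (+-comm 1 (2 * s)) index)))
          (trans (t-> (<-trans s<k (n<1+n k))) (cong (λ n → r (suc n)) index))
          (trans (t-> (<-trans s<k (<-trans (n<1+n k) (n<1+n (suc k))))) (cong (λ n → r (suc (suc n))) index))
    where
    k : ℕ
    k = s′ + suc (suc i)
    index : suc k ≡ i + (s + 2)
    index = shift s′ i
      where
      shift : ∀ s′ i → suc (s′ + suc (suc i)) ≡ i + (suc s′ + 2)
      shift = solve-∀
    s<k : s < k
    s<k = subst (s <_) (sym (+-suc s′ (suc i))) (s≤s (subst (s′ <_) (sym (+-suc s′ i)) (s≤s (m≤m+n s′ i))))

  new-run≡claimedEqns : new-run ≡ claimedEqns u v s q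
  new-run≡claimedEqns = begin
    applyUpTo F (2 * s)                    ≡⟨ cong (applyUpTo F) (split s′) ⟩
    applyUpTo F (s′ + suc (suc s′))        ≡⟨ applyUpTo-+ F s′ (suc (suc s′)) ⟩
    applyUpTo F s′ ++ F (s′ + 0) ∷ F (s′ + 1) ∷ applyUpTo (λ i → F (s′ + suc (suc i))) s′
      ≡⟨ cong₂ _++_ (applyUpTo-cong s′ new-run-ascending)
                    (cong₂ _∷_ new-run-turn₁ (cong₂ _∷_ new-run-turn₂ (applyUpTo-cong s′ new-run-descending))) ⟩
    claimedEqns u v s q                    ∎
    where
    open ≡-Reasoning
    F : ℕ → Eqn
    F = equationAt t c
    split : ∀ n → 2 * suc n ≡ n + suc (suc n)
    split = solve-∀

theorem3p1 : (u v s : ℕ) (q : ℕ → ℕ) →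
    0 < v → v < u → u ∣ (v * v + v ∸ 1) →
    1 ≤ s → (∀ i → 1 ≤ i → i ≤ s → 1 ≤ q i) →
    quotients (EA u v 1) ≡ palQuotients s q →
    EA u (v ∸ 1) 0 ≡ claimedEqns u v s q
theorem3p1 u v zero q _ _ _ () _ _
theorem3p1 u v (suc s′) q 0<v v<u u∣ _ q-pos quotients≡ = begin
  EA u (v ∸ 1) 0                      ≡⟨ cong₂ (λ a b → EA a b 0) t0≡u t1≡v∸1 ⟨
  EA (t 0) (t 1) 0                    ≡⟨ cong (EA (t 0) (t 1)) new-run-even ⟨
  EA (t 0) (t 1) (length new-run % 2) ≡⟨ EA-of-chain new-run-chain ⟩
  new-run                             ≡⟨ new-run≡claimedEqns ⟩
  claimedEqns u v (suc s′) q          ∎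
  where
  open ≡-Reasoning
  open PalindromicRun u v s′ q 0<v v<u u∣ q-pos quotients≡
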